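{- Let $p\ge 3$ be an integer and let $C_p$ be the cycle of length $p$. Then $\beta(F_2(C_p))=\big\lfloor p\lfloor p/2\rfloor/2\big\rfloor$.
   Context: For a simple finite graph $G$, the $2$-token graph $F_2(G)$ is the graph whose vertices are all $2$-element subsets of $V(G)$, two such subsets being adjacent iff their symmetric difference is an edge of $G$. $\beta(H)$ denotes the independence number of a graph $H$. -}

module Defs where

open import Data.Nat using (ℕ; suc; _<_; _≤_)
open import Data.Fin using (Fin; toℕ)
open import Data.Fin.Subset using (Subset; _∈_; _∉_; ∣_∣; ⁅_⁆; _∪_; _─_)
open import Data.Product using (_×_; Σ; ∃; ∃-syntax; _,_)
open import Data.Sum using (_⊎_)
open import Relation.Binary.PropositionalEquality using (_≡_; _≢_)
open import Relation.Nullary using (¬_)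
open import Data.List using (List; length)
open import Data.List.Relation.Unary.All using (All)
open import Data.List.Relation.Unary.AllPairs using (AllPairs)

-- The cycle C_p on vertices 0..p-1: i ~ j iff j ≡ i+1 (mod p) or i ≡ j+1 (mod p),
-- with "y ≡ x+1 mod p" written out as y = x+1, or x = p-1 and y = 0.
-- (Simple for p ≥ 3.)
CycleAdj : (p : ℕ) → Fin p → Fin p → Set
CycleAdj p i j = Succ i j ⊎ Succ j i
  where
  Succ : Fin p → Fin p → Set
  Succ x y = (toℕ y ≡ suc (toℕ x)) ⊎ ((suc (toℕ x) ≡ p) × (toℕ y ≡ 0))

TwoSubset : ℕ → Set
TwoSubset n = Σ (Fin n × Fin n) λ { (a , b) → toℕ a < toℕ b }

toSubset : ∀ {n} → TwoSubset n → Subset n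
toSubset ((a , b) , _) = ⁅ a ⁆ ∪ ⁅ b ⁆

_△_ : ∀ {n} → Subset n → Subset n → Subset n
A △ B = (A ─ B) ∪ (B ─ A)

TokenAdj : ∀ {n} → (Fin n → Fin n → Set) → TwoSubset n → TwoSubset n → Set
TokenAdj {n} Adj A B =
  ∃[ x ] ∃[ y ] (Adj x y × (toSubset A △ toSubset B) ≡ (⁅ x ⁆ ∪ ⁅ y ⁆))

IsIndependent : ∀ {n} → (Fin n → Fin n → Set) → List (TwoSubset n) → Set
IsIndependent Adj S =
  AllPairs (λ A B → (toSubset A ≢ toSubset B) × ¬ TokenAdj Adj A B × ¬ TokenAdj Adj B A) S

IndependenceNumber : ∀ {n} → (Fin n → Fin n → Set) → ℕ → Set
IndependenceNumber Adj m =
  (∃[ S ] (IsIndependent Adj S × length S ≡ m))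
  × (∀ S → IsIndependent Adj S → length S ≤ m)

-- Write a vertex of F₂(C_p) as {a, a + d} modulo p, with circular distance 1 ≤ d ≤ k = ⌊p/2⌋.
-- Upper bound: each of the p k slots (a, d) holds {a, a + d} and a partner which is equal or
-- adjacent to it ({a, a + d ± 1}, pairing 2i - 1 with 2i, and {a, a + p - k} for d = k odd),
-- and every vertex holds two different slots; so an independent set S has 2 |S| ≤ p k.
-- Lower bound: moving one token turns the difference e = y - x of {x < y} into e ± 1 or into
-- p - 1 - e, so no edge joins two vertices of odd circular distance below k, nor (k odd) two
-- vertices {b, b + p - k}.  Taking all of the former and k of the latter gives ⌊p k / 2⌋.
module Submission where

open import Data.Bool using (Bool; true; false; not)
open import Data.Empty using (⊥; ⊥-elim)
open import Data.Fin as Fin using (Fin; toℕ; fromℕ<)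
open import Data.Fin.Properties
  using (toℕ-injective; toℕ-fromℕ<; toℕ<n; pigeonhole; fromℕ<-injective) renaming (<⇒≢ to <⇒≢ᶠ)
open import Data.Fin.Subset using (Subset; _∈_; _∉_; ⁅_⁆; _∪_; _─_; inside; outside)
open import Data.Fin.Subset.Properties
  using ( x∈p∪q⁻; x∈p∪q⁺; x∈p∧x∉q⇒x∈p─q; p─q⊆p; x∈⁅x⁆; x∈⁅y⁆⇒x≡y
        ; ⊆-antisym; ∪-comm; drop-there)
open import Data.List using (List; []; _∷_; length; lookup; applyUpTo)
open import Data.List.Properties using (length-applyUpTo)
open import Data.List.Membership.Propositional.Properties using (∈-lookup)
open import Data.List.Relation.Unary.All as All using (All; []; _∷_)
open import Data.List.Relation.Unary.AllPairs using (AllPairs; []; _∷_)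
open import Data.List.Relation.Unary.AllPairs.Properties using (applyUpTo⁺₁)
open import Data.Nat
open import Data.Nat.DivMod
open import Data.Nat.Divisibility using (n∣m*n)
open import Data.Nat.Properties
open import Data.Nat.Tactic.RingSolver using (solve-∀)
open import Data.Product using (_×_; _,_; proj₁; proj₂; ∃-syntax)
open import Data.Sum using (_⊎_; inj₁; inj₂; swap)
open import Data.Vec using (_∷_; here; there)
open import Relation.Binary.Definitions using (tri<; tri≈; tri>)
open import Relation.Binary.PropositionalEquality
open import Relation.Nullary using (¬_; yes; no; contradiction)
open import Defs

x∈p─q⇒x∉q : ∀ {n} {p q : Subset n} {x : Fin n} → x ∈ p ─ q → x ∉ q
x∈p─q⇒x∉q {p = _ ∷ _} {inside ∷ _} {Fin.zero} ()
x∈p─q⇒x∉q {p = _ ∷ _} {outside ∷ _} {Fin.zero} here ()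
x∈p─q⇒x∉q {p = _ ∷ _} {_ ∷ _} {Fin.suc x} (there x∈p─q) x∈q =
  x∈p─q⇒x∉q x∈p─q (drop-there x∈q)

x∈p△q⁻ : ∀ {n} (p q : Subset n) {x : Fin n} → x ∈ p △ q → (x ∈ p × x ∉ q) ⊎ (x ∈ q × x ∉ p)
x∈p△q⁻ p q x∈p△q with x∈p∪q⁻ (p ─ q) (q ─ p) x∈p△q
... | inj₁ x∈p─q = inj₁ (p─q⊆p p q x∈p─q , x∈p─q⇒x∉q x∈p─q)
... | inj₂ x∈q─p = inj₂ (p─q⊆p q p x∈q─p , x∈p─q⇒x∉q x∈q─p)

x∈p△q⁺ : ∀ {n} {p q : Subset n} {x : Fin n} → (x ∈ p × x ∉ q) ⊎ (x ∈ q × x ∉ p) → x ∈ p △ q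
x∈p△q⁺ (inj₁ (x∈p , x∉q)) = x∈p∪q⁺ (inj₁ (x∈p∧x∉q⇒x∈p─q x∈p x∉q))
x∈p△q⁺ (inj₂ (x∈q , x∉p)) = x∈p∪q⁺ (inj₂ (x∈p∧x∉q⇒x∈p─q x∈q x∉p))

pair : ∀ {n} → Fin n → Fin n → Subset n
pair a b = ⁅ a ⁆ ∪ ⁅ b ⁆

x∈pair⁻ : ∀ {n} {a b x : Fin n} → x ∈ pair a b → x ≡ a ⊎ x ≡ b
x∈pair⁻ {a = a} {b} x∈ab with x∈p∪q⁻ ⁅ a ⁆ ⁅ b ⁆ x∈ab
... | inj₁ x∈a = inj₁ (x∈⁅y⁆⇒x≡y a x∈a)
... | inj₂ x∈b = inj₂ (x∈⁅y⁆⇒x≡y b x∈b)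

a∈pair : ∀ {n} (a b : Fin n) → a ∈ pair a b
a∈pair a b = x∈p∪q⁺ (inj₁ (x∈⁅x⁆ a))

b∈pair : ∀ {n} (a b : Fin n) → b ∈ pair a b
b∈pair a b = x∈p∪q⁺ (inj₂ (x∈⁅x⁆ b))

x∉pair : ∀ {n} {a b x : Fin n} → x ≢ a → x ≢ b → x ∉ pair a b
x∉pair x≢a x≢b x∈ab with x∈pair⁻ x∈ab
... | inj₁ x≡a = x≢a x≡a
... | inj₂ x≡b = x≢b x≡b

pair-comm : ∀ {n} (a b : Fin n) → pair a b ≡ pair b a
pair-comm a b = ∪-comm ⁅ a ⁆ ⁅ b ⁆

pair△pair : ∀ {n} {u w w' : Fin n} → u ≢ w → u ≢ w' → w ≢ w' → pair u w △ pair u w' ≡ pair w w'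
pair△pair {u = u} {w} {w'} u≢w u≢w' w≢w' = ⊆-antisym ⊆ ⊇
  where
  ⊆ : ∀ {x} → x ∈ pair u w △ pair u w' → x ∈ pair w w'
  ⊆ x∈ with x∈p△q⁻ (pair u w) (pair u w') x∈
  ... | inj₁ (x∈uw , x∉uw') with x∈pair⁻ x∈uw
  ...   | inj₁ refl = ⊥-elim (x∉uw' (a∈pair u w'))
  ...   | inj₂ refl = a∈pair w w'
  ⊆ x∈ | inj₂ (x∈uw' , x∉uw) with x∈pair⁻ x∈uw'
  ...   | inj₁ refl = ⊥-elim (x∉uw (a∈pair u w))
  ...   | inj₂ refl = b∈pair w w'
  ⊇ : ∀ {x} → x ∈ pair w w' → x ∈ pair u w △ pair u w'
  ⊇ x∈ with x∈pair⁻ x∈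
  ... | inj₁ refl = x∈p△q⁺ (inj₁ (b∈pair u w , x∉pair (≢-sym u≢w) w≢w'))
  ... | inj₂ refl = x∈p△q⁺ (inj₂ (b∈pair u w' , x∉pair (≢-sym u≢w') (≢-sym w≢w')))

pair-injective : ∀ {n} {x y x' y' : Fin n} → toℕ x < toℕ y → toℕ x' < toℕ y' →
                 pair x y ≡ pair x' y' → x ≡ x' × y ≡ y'
pair-injective {x = x} {y} {x'} {y'} x<y x'<y' eq
  with x∈pair⁻ (subst (x ∈_) eq (a∈pair x y))
     | x∈pair⁻ (subst (y ∈_) eq (b∈pair x y))
     | x∈pair⁻ (subst (x' ∈_) (sym eq) (a∈pair x' y'))
... | inj₁ refl | inj₁ refl | _         = contradiction x<y (<-irrefl refl)
... | inj₁ refl | inj₂ refl | _         = refl , refl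
... | inj₂ refl | _         | inj₁ refl = contradiction x'<y' (<-irrefl refl)
... | inj₂ refl | _         | inj₂ refl = contradiction (<-trans x'<y' x<y) (<-irrefl refl)

AllPairs-lookup : ∀ {A : Set} {R : A → A → Set} {xs : List A} → AllPairs R xs →
                  ∀ {i j} → i Fin.< j → R (lookup xs i) (lookup xs j)
AllPairs-lookup (Rx ∷ _)   {Fin.zero}  {Fin.suc j} _         = All.lookup Rx (∈-lookup j)
AllPairs-lookup (_ ∷ Rxs) {Fin.suc i} {Fin.suc j} (s≤s i<j) = AllPairs-lookup Rxs i<j

distinct-bounded⇒length≤ : ∀ {M} {xs : List ℕ} → AllPairs _≢_ xs → All (_< M) xs → length xs ≤ M
distinct-bounded⇒length≤ {M} {xs} distinct bounded with length xs ≤? M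
... | yes ≤M = ≤M
... | no ≰M with i , j , i<j , eq ← pigeonhole (≰⇒> ≰M) (λ i → fromℕ< (All.lookup bounded (∈-lookup i)))
  = contradiction (fromℕ<-injective _ _ _ _ eq) (AllPairs-lookup distinct i<j)

module SlotCounting {V : Set} (Independent : V → V → Set) (M : ℕ) (slot : Bool → V → ℕ)
  (slot<M : ∀ b v → slot b v < M)
  (slot-false≢true : ∀ v → slot false v ≢ slot true v)
  (independent⇒slot≢ : ∀ {u v} → Independent u v → ∀ b b' → slot b u ≢ slot b' v)
  where

  slots : List V → List ℕ
  slots []      = []
  slots (v ∷ S) = slot false v ∷ slot true v ∷ slots S

  length-slots : ∀ S → length (slots S) ≡ length S + length S
  length-slots []      = refl
  length-slots (v ∷ S) = cong suc (trans (cong suc (length-slots S)) (sym (+-suc (length S) (length S))))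

  slots<M : ∀ S → All (_< M) (slots S)
  slots<M []      = []
  slots<M (v ∷ S) = slot<M false v ∷ slot<M true v ∷ slots<M S

  slot∉slots : ∀ {v} b S → All (Independent v) S → All (slot b v ≢_) (slots S)
  slot∉slots b []      []        = []
  slot∉slots b (u ∷ S) (vu ∷ vS) =
    independent⇒slot≢ vu b false ∷ independent⇒slot≢ vu b true ∷ slot∉slots b S vS

  slots-distinct : ∀ S → AllPairs Independent S → AllPairs _≢_ (slots S)
  slots-distinct []      []        = []
  slots-distinct (v ∷ S) (vS ∷ IS) =
    (slot-false≢true v ∷ slot∉slots false S vS) ∷ slot∉slots true S vS ∷ slots-distinct S IS

  twice-length≤ : ∀ S → AllPairs Independent S → length S + length S ≤ M
  twice-length≤ S IS = subst (_≤ M) (length-slots S)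
    (distinct-bounded⇒length≤ (slots-distinct S IS) (slots<M S))

[m+n*2]/2≡m/2+n : ∀ m n → (m + n * 2) / 2 ≡ m / 2 + n
[m+n*2]/2≡m/2+n m n = trans (+-distrib-/-∣ʳ m (n∣m*n n)) (cong (m / 2 +_) (m*n/n≡m n 2))

n+n≤m⇒n≤m/2 : ∀ {n m} → n + n ≤ m → n ≤ m / 2
n+n≤m⇒n≤m/2 {n} {m} n+n≤m =
  subst (_≤ m / 2) (m*n/n≡m n 2) (/-monoˡ-≤ 2 (subst (_≤ m) (n+n≡n*2 n) n+n≤m))
  where
  n+n≡n*2 : ∀ n → n + n ≡ n * 2
  n+n≡n*2 = solve-∀

k+k+r≡r+k*2 : ∀ k r → k + k + r ≡ r + k * 2
k+k+r≡r+k*2 = solve-∀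

isEven : ℕ → Bool
isEven zero    = true
isEven (suc n) = not (isEven n)

Odd : ℕ → Set
Odd n = isEven n ≡ false

-- The cycle has p = 2k + r vertices, so that k = ⌊p/2⌋ is the largest circular distance.
module CycleGraph (k r : ℕ) (r≤1 : r ≤ 1) (3≤p : 3 ≤ k + k + r) where

  p : ℕ
  p = k + k + r

  instance
    p-nonZero : NonZero p
    p-nonZero = >-nonZero (≤-trans (s≤s z≤n) 3≤p)

  1+k<p : suc k < p
  1+k<p = go k 3≤p
    where
    go : ∀ k → 3 ≤ k + k + r → suc k < k + k + r
    go zero          3≤r = contradiction (≤-trans 3≤r r≤1) λ { (s≤s ()) }
    go (suc zero)    3≤p = 3≤p
    go (suc (suc j)) _   = ≤-trans (+-monoˡ-≤ (suc (suc j)) (s≤s (s≤s z≤n))) (m≤m+n _ r)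

  k<p : k < p
  k<p = <-trans (n<1+n k) 1+k<p

  1≤k : 1 ≤ k
  1≤k = go k 1+k<p
    where
    go : ∀ k → suc k < k + k + r → 1 ≤ k
    go zero    1<r = contradiction (≤-trans 1<r r≤1) λ { (s≤s ()) }
    go (suc _) _   = s≤s z≤n

  k+k≤p : k + k ≤ p
  k+k≤p = m≤m+n (k + k) r

  toFin : ℕ → Fin p
  toFin n = fromℕ< (m%n<n n p)

  toℕ-toFin : ∀ n → toℕ (toFin n) ≡ n % p
  toℕ-toFin n = toℕ-fromℕ< (m%n<n n p)

  toℕ-toFin-< : ∀ {n} → n < p → toℕ (toFin n) ≡ n
  toℕ-toFin-< {n} n<p = trans (toℕ-toFin n) (m<n⇒m%n≡m n<p)

  toℕ-toFin-≥ : ∀ {n} → p ≤ n → n < p + p → toℕ (toFin n) ≡ n ∸ p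
  toℕ-toFin-≥ {n} p≤n n<2p = begin
    toℕ (toFin n)  ≡⟨ toℕ-toFin n ⟩
    n % p          ≡⟨ m≤n⇒[n∸m]%m≡n%m p≤n ⟨
    (n ∸ p) % p    ≡⟨ m<n⇒m%n≡m (+-cancelʳ-< p (n ∸ p) p (subst (_< p + p) (sym (m∸n+n≡m p≤n)) n<2p)) ⟩
    n ∸ p          ∎
    where open ≡-Reasoning

  toFin-cong : ∀ {m n} → m % p ≡ n % p → toFin m ≡ toFin n
  toFin-cong {m} {n} eq = toℕ-injective (trans (toℕ-toFin m) (trans eq (sym (toℕ-toFin n))))

  toFin-toℕ : ∀ (x : Fin p) → toFin (toℕ x) ≡ x
  toFin-toℕ x = toℕ-injective (toℕ-toFin-< (toℕ<n x))

  toFin-% : ∀ n → toFin (n % p) ≡ toFin n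
  toFin-% n = toFin-cong (m%n%n≡m%n n p)

  toFin-+p : ∀ n → toFin (n + p) ≡ toFin n
  toFin-+p n = toFin-cong ([m+n]%n≡m%n n p)

  [m%p+n]%p≡[m+n]%p : ∀ m n → (m % p + n) % p ≡ (m + n) % p
  [m%p+n]%p≡[m+n]%p m n = begin
    (m % p + n) % p          ≡⟨ %-distribˡ-+ (m % p) n p ⟩
    (m % p % p + n % p) % p  ≡⟨ cong (λ x → (x + n % p) % p) (m%n%n≡m%n m p) ⟩
    (m % p + n % p) % p      ≡⟨ %-distribˡ-+ m n p ⟨
    (m + n) % p              ∎
    where open ≡-Reasoning

  toFin-%+ : ∀ m n → toFin (m % p + n) ≡ toFin (m + n)
  toFin-%+ m n = toFin-cong ([m%p+n]%p≡[m+n]%p m n)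

  toFin-+-≢ : ∀ u {d} → 0 < d → d < p → toFin u ≢ toFin (u + d)
  toFin-+-≢ u {d} 0<d d<p eq = below-p (m%n<n u p) (trans (toFin-% u) (trans eq (sym (toFin-%+ u d))))
    where
    below-p : ∀ {c} → c < p → toFin c ≢ toFin (c + d)
    below-p {c} c<p eq with c + d <? p
    ... | yes c+d<p = <-irrefl c≡c+d (m<m+n c 0<d)
      where
      c≡c+d : c ≡ c + d
      c≡c+d = trans (sym (toℕ-toFin-< c<p)) (trans (cong toℕ eq) (toℕ-toFin-< c+d<p))
    ... | no c+d≮p = <-irrefl (+-cancelˡ-≡ c d p c+d≡c+p) d<p
      where
      p≤c+d : p ≤ c + d
      p≤c+d = ≮⇒≥ c+d≮p
      c≡c+d∸p : c ≡ c + d ∸ p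
      c≡c+d∸p = trans (sym (toℕ-toFin-< c<p)) (trans (cong toℕ eq) (toℕ-toFin-≥ p≤c+d (+-mono-< c<p d<p)))
      c+d≡c+p : c + d ≡ c + p
      c+d≡c+p = trans (sym (m∸n+n≡m p≤c+d)) (cong (_+ p) (sym c≡c+d∸p))

  toℕ-toFin-suc : ∀ w → toℕ (toFin (suc w)) ≡ suc (w % p) % p
  toℕ-toFin-suc w = begin
    toℕ (toFin (suc w))  ≡⟨ toℕ-toFin (suc w) ⟩
    suc w % p            ≡⟨ cong (_% p) (+-comm 1 w) ⟩
    (w + 1) % p          ≡⟨ [m%p+n]%p≡[m+n]%p w 1 ⟨
    (w % p + 1) % p      ≡⟨ cong (_% p) (+-comm (w % p) 1) ⟩
    suc (w % p) % p      ∎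
    where open ≡-Reasoning

  toFin-adjacent : ∀ w → CycleAdj p (toFin w) (toFin (suc w))
  toFin-adjacent w with m≤n⇒m<n∨m≡n (m%n<n w p)
  ... | inj₁ 1+w%p<p = inj₁ (inj₁ (trans (toℕ-toFin-suc w)
                                     (trans (m<n⇒m%n≡m 1+w%p<p) (cong suc (sym (toℕ-toFin w))))))
  ... | inj₂ 1+w%p≡p = inj₁ (inj₂ (trans (cong suc (toℕ-toFin w)) 1+w%p≡p ,
                                    trans (toℕ-toFin-suc w) (trans (cong (_% p) 1+w%p≡p) (n%n≡0 p))))

  Adjacent : Subset p → Subset p → Set
  Adjacent S T = ∃[ x ] ∃[ y ] (CycleAdj p x y × S △ T ≡ pair x y)

  adjacent-sym : ∀ {S T} → Adjacent S T → Adjacent T S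
  adjacent-sym {S} {T} (x , y , x~y , S△T≡xy) = x , y , x~y , trans (∪-comm (T ─ S) (S ─ T)) S△T≡xy

  chord : ℕ × ℕ → Subset p
  chord (a , d) = pair (toFin a) (toFin (a + d))

  chord-adjacent : ∀ a {d} → 0 < d → suc d < p → Adjacent (chord (a , d)) (chord (a , suc d))
  chord-adjacent a {d} 0<d 1+d<p =
    toFin (a + d) , toFin (a + suc d) ,
    subst (λ n → CycleAdj p (toFin (a + d)) (toFin n)) (sym (+-suc a d)) (toFin-adjacent (a + d)) ,
    pair△pair (toFin-+-≢ a 0<d (<-trans (n<1+n d) 1+d<p)) (toFin-+-≢ a (s≤s z≤n) 1+d<p)
      (subst (λ n → toFin (a + d) ≢ toFin n) a+d+1≡a+[1+d] (toFin-+-≢ (a + d) (s≤s z≤n) 1<p))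
    where
    1<p : 1 < p
    1<p = ≤-trans (s≤s (s≤s z≤n)) 3≤p
    a+d+1≡a+[1+d] : a + d + 1 ≡ a + suc d
    a+d+1≡a+[1+d] = trans (+-assoc a d 1) (cong (a +_) (+-comm d 1))

  -- The upper bound

  SameOrAdjacent : Subset p → Subset p → Set
  SameOrAdjacent S T = S ≡ T ⊎ Adjacent S T ⊎ Adjacent T S

  SameOrAdjacent-sym : ∀ {S T} → SameOrAdjacent S T → SameOrAdjacent T S
  SameOrAdjacent-sym (inj₁ S≡T)        = inj₁ (sym S≡T)
  SameOrAdjacent-sym (inj₂ (inj₁ S~T)) = inj₂ (inj₂ S~T)
  SameOrAdjacent-sym (inj₂ (inj₂ T~S)) = inj₂ (inj₁ T~S)

  k+r≡k⊎k+r≡1+k : k + r ≡ k ⊎ k + r ≡ suc k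
  k+r≡k⊎k+r≡1+k = go r≤1
    where
    go : ∀ {r} → r ≤ 1 → k + r ≡ k ⊎ k + r ≡ suc k
    go z≤n       = inj₁ (+-identityʳ k)
    go (s≤s z≤n) = inj₂ (+-comm k 1)

  data DistanceClass (d : ℕ) : Set where
    even      : isEven d ≡ true → DistanceClass d
    odd-short : Odd d → d < k → DistanceClass d
    odd-long  : Odd d → ¬ d < k → DistanceClass d

  classify : ∀ d → DistanceClass d
  classify d with isEven d in e | d <? k
  ... | true  | _       = even e
  ... | false | yes d<k = odd-short e d<k
  ... | false | no d≮k  = odd-long e d≮k

  ValidSlot : ℕ × ℕ → Set
  ValidSlot (a , d) = a < p × 1 ≤ d × d ≤ k

  partner : ℕ × ℕ → Subset p
  partner (a , d) with classify d
  ... | even _        = chord (a , d ∸ 1)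
  ... | odd-short _ _ = chord (a , suc d)
  ... | odd-long _ _  = chord (a , k + r)

  secondSlot : ℕ × ℕ → ℕ × ℕ
  secondSlot (a , d) with classify d
  ... | even _        = a , d ∸ 1
  ... | odd-short _ _ = a , suc d
  ... | odd-long _ _  = (a + k) % p , k

  even-suc⇒0< : ∀ d → isEven (suc d) ≡ true → 0 < d
  even-suc⇒0< zero    ()
  even-suc⇒0< (suc d) _ = s≤s z≤n

  chord-partner : ∀ {s} → ValidSlot s → SameOrAdjacent (chord s) (partner s)
  chord-partner {a , suc d} (_ , s≤s z≤n , 1+d≤k) with classify (suc d)
  ... | even e          = inj₂ (inj₂ (chord-adjacent a (even-suc⇒0< d e) (≤-<-trans 1+d≤k k<p)))
  ... | odd-short _ d<k = inj₂ (inj₁ (chord-adjacent a (s≤s z≤n) (≤-<-trans d<k k<p)))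
  ... | odd-long _ d≮k with ≤-antisym 1+d≤k (≮⇒≥ d≮k) | k+r≡k⊎k+r≡1+k
  ...   | refl | inj₁ k+r≡k  = inj₁ (cong (λ n → chord (a , n)) (sym k+r≡k))
  ...   | refl | inj₂ k+r≡1+k =
    inj₂ (inj₁ (subst (λ n → Adjacent (chord (a , k)) (chord (a , n))) (sym k+r≡1+k)
                      (chord-adjacent a 1≤k 1+k<p)))

  partner-secondSlot : ∀ {s} → ValidSlot s → chord s ≡ partner (secondSlot s)
  partner-secondSlot {a , suc d} (_ , s≤s z≤n , 1+d≤k) with classify (suc d)
  ... | even e with classify d
  ...   | even e'          = contradiction (trans (sym e) (cong not e')) λ ()
  ...   | odd-short _ _    = refl
  ...   | odd-long _ d≮k   = contradiction (<-≤-trans (n<1+n d) 1+d≤k) d≮k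
  partner-secondSlot {a , suc d} _ | odd-short o _ with classify (suc (suc d))
  ...   | even _           = refl
  ...   | odd-short o' _   = contradiction (trans (sym (cong not o)) o') λ ()
  ...   | odd-long o' _    = contradiction (trans (sym (cong not o)) o') λ ()
  partner-secondSlot {a , suc d} (_ , _ , 1+d≤k) | odd-long o d≮k with ≤-antisym 1+d≤k (≮⇒≥ d≮k)
  ... | refl with classify k
  ...   | even e           = contradiction (trans (sym o) e) λ ()
  ...   | odd-short _ k<k  = contradiction k<k (<-irrefl refl)
  ...   | odd-long _ _     = trans (pair-comm (toFin a) (toFin (a + k)))
                               (cong₂ pair (sym (toFin-% (a + k))) (sym wraps-to-a))
    where
    wraps-to-a : toFin ((a + k) % p + (k + r)) ≡ toFin a
    wraps-to-a = begin
      toFin ((a + k) % p + (k + r))  ≡⟨ toFin-%+ (a + k) (k + r) ⟩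
      toFin (a + k + (k + r))        ≡⟨ cong toFin (a+k+[k+r]≡a+p a k r) ⟩
      toFin (a + p)                  ≡⟨ toFin-+p a ⟩
      toFin a                        ∎
      where
      open ≡-Reasoning
      a+k+[k+r]≡a+p : ∀ a k r → a + k + (k + r) ≡ a + (k + k + r)
      a+k+[k+r]≡a+p = solve-∀

  secondSlot-valid : ∀ {s} → ValidSlot s → ValidSlot (secondSlot s)
  secondSlot-valid {a , suc d} (a<p , s≤s z≤n , 1+d≤k) with classify (suc d)
  ... | even e          = a<p , even-suc⇒0< d e , ≤-trans (n≤1+n d) 1+d≤k
  ... | odd-short _ d<k = a<p , s≤s z≤n , d<k
  ... | odd-long _ _    = m%n<n (a + k) p , 1≤k , ≤-refl

  secondSlot≢ : ∀ {s} → ValidSlot s → secondSlot s ≢ s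
  secondSlot≢ {a , suc d} (a<p , s≤s z≤n , 1+d≤k) with classify (suc d)
  ... | even _        = λ eq → <-irrefl (cong proj₂ eq) (n<1+n d)
  ... | odd-short _ _ = λ eq → <-irrefl (sym (cong proj₂ eq)) (n<1+n (suc d))
  ... | odd-long _ _  = λ eq →
    toFin-+-≢ a 1≤k k<p (trans (cong toFin (sym (cong proj₁ eq))) (toFin-% (a + k)))

  code : ℕ × ℕ → ℕ
  code (a , d) = a + (d ∸ 1) * p

  code< : ∀ {s} → ValidSlot s → code s < p * k
  code< {a , suc d} (a<p , s≤s z≤n , 1+d≤k) = begin-strict
    a + d * p      <⟨ +-monoˡ-< (d * p) a<p ⟩
    p + d * p      ≡⟨⟩
    suc d * p      ≤⟨ *-monoˡ-≤ p 1+d≤k ⟩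
    k * p          ≡⟨ *-comm k p ⟩
    p * k          ∎
    where open ≤-Reasoning

  code-injective : ∀ {s t} → ValidSlot s → ValidSlot t → code s ≡ code t → s ≡ t
  code-injective {a , suc d} {a' , suc d'} (a<p , _) (a'<p , _) eq = cong₂ _,_ a≡a' (cong suc d≡d')
    where
    a≡a' : a ≡ a'
    a≡a' = begin
      a                  ≡⟨ m<n⇒m%n≡m a<p ⟨
      a % p              ≡⟨ [m+kn]%n≡m%n a d p ⟨
      (a + d * p) % p    ≡⟨ cong (_% p) eq ⟩
      (a' + d' * p) % p  ≡⟨ [m+kn]%n≡m%n a' d' p ⟩
      a' % p             ≡⟨ m<n⇒m%n≡m a'<p ⟩
      a'                 ∎
      where open ≡-Reasoning
    d≡d' : d ≡ d'
    d≡d' = *-cancelʳ-≡ d d' p (+-cancelˡ-≡ a _ _ (trans eq (cong (_+ d' * p) (sym a≡a'))))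

  V : Set
  V = TwoSubset p

  lo hi : V → ℕ
  lo ((x , _) , _) = toℕ x
  hi ((_ , y) , _) = toℕ y

  toSubset≡pair : ∀ v → toSubset v ≡ pair (toFin (lo v)) (toFin (hi v))
  toSubset≡pair ((x , y) , _) = sym (cong₂ pair (toFin-toℕ x) (toFin-toℕ y))

  lo<hi : ∀ v → lo v < hi v
  lo<hi (_ , x<y) = x<y

  hi<p : ∀ v → hi v < p
  hi<p ((_ , y) , _) = toℕ<n y

  Occupies : Subset p → ℕ × ℕ → Set
  Occupies S s = S ≡ chord s ⊎ S ≡ partner s

  co-occupants : ∀ {s S T} → ValidSlot s → Occupies S s → Occupies T s → SameOrAdjacent S T
  co-occupants _     (inj₁ refl) (inj₁ refl) = inj₁ refl
  co-occupants _     (inj₂ refl) (inj₂ refl) = inj₁ refl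
  co-occupants valid (inj₁ refl) (inj₂ refl) = chord-partner valid
  co-occupants valid (inj₂ refl) (inj₁ refl) = SameOrAdjacent-sym (chord-partner valid)

  circular : ℕ → ℕ → ℕ × ℕ
  circular X Y with Y ∸ X ≤? k
  ... | yes _ = X , Y ∸ X
  ... | no _  = Y , p ∸ (Y ∸ X)

  p∸e≤k : ∀ {e} → k < e → p ∸ e ≤ k
  p∸e≤k {e} k<e = m≤n+o⇒m∸n≤o p e (begin
    k + k + r  ≤⟨ +-monoʳ-≤ (k + k) r≤1 ⟩
    k + k + 1  ≡⟨ k+k+1≡1+k+k k ⟩
    suc k + k  ≤⟨ +-monoˡ-≤ k k<e ⟩
    e + k      ∎)
    where
    open ≤-Reasoning
    k+k+1≡1+k+k : ∀ k → k + k + 1 ≡ suc k + k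
    k+k+1≡1+k+k = solve-∀

  circular-occupied : ∀ {X Y} → X < Y → Y < p →
                      pair (toFin X) (toFin Y) ≡ chord (circular X Y) × ValidSlot (circular X Y)
  circular-occupied {X} {Y} X<Y Y<p with Y ∸ X ≤? k
  ... | yes Y∸X≤k = (cong (λ n → pair (toFin X) (toFin n)) (sym (m+[n∸m]≡n (<⇒≤ X<Y))))
                  , <-trans X<Y Y<p , m<n⇒0<n∸m X<Y , Y∸X≤k
  ... | no Y∸X≰k  = (trans (pair-comm (toFin X) (toFin Y)) (cong (pair (toFin Y)) (sym wraps-to-X)))
                  , Y<p , m<n⇒0<n∸m Y∸X<p , p∸e≤k (≰⇒> Y∸X≰k)
    where
    Y∸X<p : Y ∸ X < p
    Y∸X<p = ≤-<-trans (m∸n≤m Y X) Y<p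
    wraps-to-X : toFin (Y + (p ∸ (Y ∸ X))) ≡ toFin X
    wraps-to-X = begin
      toFin (Y + (p ∸ (Y ∸ X)))
        ≡⟨ cong (λ n → toFin (n + (p ∸ (Y ∸ X)))) (m+[n∸m]≡n (<⇒≤ X<Y)) ⟨
      toFin (X + (Y ∸ X) + (p ∸ (Y ∸ X)))    ≡⟨ cong toFin (+-assoc X (Y ∸ X) _) ⟩
      toFin (X + ((Y ∸ X) + (p ∸ (Y ∸ X))))  ≡⟨ cong (λ n → toFin (X + n)) (m+[n∸m]≡n (<⇒≤ Y∸X<p)) ⟩
      toFin (X + p)                          ≡⟨ toFin-+p X ⟩
      toFin X                                ∎
      where open ≡-Reasoning

  slot : Bool → V → ℕ × ℕ
  slot false v = circular (lo v) (hi v)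
  slot true  v = secondSlot (circular (lo v) (hi v))

  slot-occupied : ∀ b v → Occupies (toSubset v) (slot b v) × ValidSlot (slot b v)
  slot-occupied false v = inj₁ (trans (toSubset≡pair v) (proj₁ occ)) , proj₂ occ
    where occ = circular-occupied (lo<hi v) (hi<p v)
  slot-occupied true  v = inj₂ (trans (toSubset≡pair v) (trans (proj₁ occ) (partner-secondSlot (proj₂ occ))))
                        , secondSlot-valid (proj₂ occ)
    where occ = circular-occupied (lo<hi v) (hi<p v)

  Independent : V → V → Set
  Independent A B = (toSubset A ≢ toSubset B) × ¬ TokenAdj (CycleAdj p) A B × ¬ TokenAdj (CycleAdj p) B A

  slot-false≢true : ∀ v → code (slot false v) ≢ code (slot true v)
  slot-false≢true v eq = secondSlot≢ valid (sym (code-injective valid (secondSlot-valid valid) eq))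
    where valid = proj₂ (slot-occupied false v)

  independent⇒slot≢ : ∀ {u v} → Independent u v → ∀ b b' → code (slot b u) ≢ code (slot b' v)
  independent⇒slot≢ {u} {v} (u≢v , ¬u~v , ¬v~u) b b' eq
    with slot-occupied b u | slot-occupied b' v
  ... | occ , valid | occ' , valid'
    with co-occupants valid occ (subst (Occupies (toSubset v)) (sym (code-injective valid valid' eq)) occ')
  ... | inj₁ u≡v        = u≢v u≡v
  ... | inj₂ (inj₁ u~v) = ¬u~v u~v
  ... | inj₂ (inj₂ v~u) = ¬v~u v~u

  open SlotCounting Independent (p * k) (λ b v → code (slot b v))
         (λ b v → code< (proj₂ (slot-occupied b v))) slot-false≢true independent⇒slot≢
    using (twice-length≤)

  >⇒≢ᶠ : ∀ {i j : Fin p} → toℕ j < toℕ i → i ≢ j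
  >⇒≢ᶠ j<i = ≢-sym (<⇒≢ᶠ j<i)

  -- Moving one token

  adjacent⇒≢ : ∀ {S T} → Adjacent S T → S ≢ T
  adjacent⇒≢ {S} (u , w , _ , S△T≡uw) refl with x∈p△q⁻ S S (subst (u ∈_) (sym S△T≡uw) (a∈pair u w))
  ... | inj₁ (u∈S , u∉S) = u∉S u∈S
  ... | inj₂ (u∈S , u∉S) = u∉S u∈S

  moved-adjacent : ∀ {S T α β} → Adjacent S T → α ∈ S → α ∉ T → β ∈ T → β ∉ S → CycleAdj p α β
  moved-adjacent {S} {T} {α} {β} (u , w , u~w , S△T≡uw) α∈S α∉T β∈T β∉S
    with x∈pair⁻ (subst (α ∈_) S△T≡uw (x∈p△q⁺ (inj₁ (α∈S , α∉T))))
       | x∈pair⁻ (subst (β ∈_) S△T≡uw (x∈p△q⁺ (inj₂ (β∈T , β∉S))))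
  ... | inj₁ refl | inj₁ refl = contradiction α∈S β∉S
  ... | inj₂ refl | inj₂ refl = contradiction α∈S β∉S
  ... | inj₁ refl | inj₂ refl = u~w
  ... | inj₂ refl | inj₁ refl = swap u~w

  E : V → ℕ
  E v = hi v ∸ lo v

  DifferenceStep : ℕ → ℕ → Set
  DifferenceStep e e' = e' ≡ suc e ⊎ e ≡ suc e' ⊎ suc (e + e') ≡ p

  DifferenceStep-sym : ∀ {e e'} → DifferenceStep e e' → DifferenceStep e' e
  DifferenceStep-sym (inj₁ e'≡1+e)       = inj₂ (inj₁ e'≡1+e)
  DifferenceStep-sym (inj₂ (inj₁ e≡1+e')) = inj₁ e≡1+e'
  DifferenceStep-sym {e} {e'} (inj₂ (inj₂ 1+e+e'≡p)) = inj₂ (inj₂ (trans (cong suc (+-comm e' e)) 1+e+e'≡p))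

  ∸-suc : ∀ {m n} → m < n → n ∸ m ≡ suc (n ∸ suc m)
  ∸-suc {zero}  {suc n} _         = refl
  ∸-suc {suc m} {suc n} (s≤s m<n) = ∸-suc m<n

  1+n≮n : ∀ {n} → ¬ suc n < n
  1+n≮n 1+n<n = <-asym 1+n<n (n<1+n _)

  step-shared-lo : ∀ {x y y' : Fin p} → toℕ x < toℕ y → toℕ x < toℕ y' → CycleAdj p y y' →
                   DifferenceStep (toℕ y ∸ toℕ x) (toℕ y' ∸ toℕ x)
  step-shared-lo {x} x<y _ (inj₁ (inj₁ y'≡1+y)) =
    inj₁ (trans (cong (_∸ toℕ x) y'≡1+y) (+-∸-assoc 1 (<⇒≤ x<y)))
  step-shared-lo _ x<y' (inj₁ (inj₂ (_ , y'≡0))) = contradiction y'≡0 (m<n⇒n≢0 x<y')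
  step-shared-lo {x} _ x<y' (inj₂ (inj₁ y≡1+y')) =
    inj₂ (inj₁ (trans (cong (_∸ toℕ x) y≡1+y') (+-∸-assoc 1 (<⇒≤ x<y'))))
  step-shared-lo x<y _ (inj₂ (inj₂ (_ , y≡0))) = contradiction y≡0 (m<n⇒n≢0 x<y)

  step-shared-hi : ∀ {x x' y : Fin p} → toℕ x < toℕ y → toℕ x' < toℕ y → CycleAdj p x x' →
                   DifferenceStep (toℕ y ∸ toℕ x) (toℕ y ∸ toℕ x')
  step-shared-hi {y = y} x<y _ (inj₁ (inj₁ x'≡1+x)) =
    inj₂ (inj₁ (trans (∸-suc x<y) (cong (λ z → suc (toℕ y ∸ z)) (sym x'≡1+x))))
  step-shared-hi {y = y} x<y _ (inj₁ (inj₂ (1+x≡p , _))) =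
    contradiction 1+x≡p (<⇒≢ (≤-<-trans x<y (toℕ<n y)))
  step-shared-hi {y = y} _ x'<y (inj₂ (inj₁ x≡1+x')) =
    inj₁ (trans (∸-suc x'<y) (cong (λ z → suc (toℕ y ∸ z)) (sym x≡1+x')))
  step-shared-hi {y = y} _ x'<y (inj₂ (inj₂ (1+x'≡p , _))) =
    contradiction 1+x'≡p (<⇒≢ (≤-<-trans x'<y (toℕ<n y)))

  -- x' < x < y, and the token on y moves to x' across the edge {p - 1, 0}
  step-around : ∀ {x' x y : Fin p} → toℕ x' < toℕ x → toℕ x < toℕ y → CycleAdj p y x' →
                DifferenceStep (toℕ y ∸ toℕ x) (toℕ x ∸ toℕ x')
  step-around x'<x x<y (inj₁ (inj₁ x'≡1+y)) = contradiction (subst (_< _) x'≡1+y (<-trans x'<x x<y)) 1+n≮n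
  step-around {x' = x'} {x} {y} x'<x x<y (inj₁ (inj₂ (1+y≡p , x'≡0))) = inj₂ (inj₂ (begin
    suc ((toℕ y ∸ toℕ x) + (toℕ x ∸ toℕ x'))
      ≡⟨ cong (λ z → suc ((toℕ y ∸ toℕ x) + (toℕ x ∸ z))) x'≡0 ⟩
    suc ((toℕ y ∸ toℕ x) + toℕ x)             ≡⟨ cong suc (m∸n+n≡m (<⇒≤ x<y)) ⟩
    suc (toℕ y)                               ≡⟨ 1+y≡p ⟩
    p                                         ∎))
    where open ≡-Reasoning
  step-around x'<x x<y (inj₂ (inj₁ y≡1+x'))      = contradiction (sym y≡1+x') (<⇒≢ (≤-<-trans x'<x x<y))
  step-around _    x<y (inj₂ (inj₂ (_ , y≡0)))   = contradiction y≡0 (m<n⇒n≢0 x<y)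

  adjacent-disjoint-impossible : ∀ {x y x' y' : Fin p} → x ≢ y → Adjacent (pair x y) (pair x' y') →
    x ≢ x' → x ≢ y' → y ≢ x' → y ≢ y' → ⊥
  adjacent-disjoint-impossible {x} {y} {x'} {y'} x≢y (u , w , _ , △≡uw) x≢x' x≢y' y≢x' y≢y'
    with moved x (a∈pair x y) (x∉pair x≢x' x≢y') | moved y (b∈pair x y) (x∉pair y≢x' y≢y')
       | moved′ x' (a∈pair x' y') (x∉pair (≢-sym x≢x') (≢-sym y≢x'))
    where
    moved : ∀ z → z ∈ pair x y → z ∉ pair x' y' → z ≡ u ⊎ z ≡ w
    moved z z∈ z∉ = x∈pair⁻ (subst (z ∈_) △≡uw (x∈p△q⁺ (inj₁ (z∈ , z∉))))
    moved′ : ∀ z → z ∈ pair x' y' → z ∉ pair x y → z ≡ u ⊎ z ≡ w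
    moved′ z z∈ z∉ = x∈pair⁻ (subst (z ∈_) △≡uw (x∈p△q⁺ (inj₂ (z∈ , z∉))))
  ... | inj₁ refl | inj₁ refl | _         = x≢y refl
  ... | inj₂ refl | inj₂ refl | _         = x≢y refl
  ... | inj₁ refl | inj₂ refl | inj₁ refl = x≢x' refl
  ... | inj₁ refl | inj₂ refl | inj₂ refl = y≢x' refl
  ... | inj₂ refl | inj₁ refl | inj₁ refl = y≢x' refl
  ... | inj₂ refl | inj₁ refl | inj₂ refl = x≢x' refl

  difference-step : ∀ A B → TokenAdj (CycleAdj p) A B → DifferenceStep (E A) (E B)
  difference-step ((x , y) , x<y) ((x' , y') , x'<y') A~B
    with x Fin.≟ x' | x Fin.≟ y' | y Fin.≟ x' | y Fin.≟ y'
  ... | yes refl | _ | _ | yes refl = contradiction refl (adjacent⇒≢ A~B)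
  ... | yes refl | _ | _ | no y≢y' = step-shared-lo x<y x'<y'
    (moved-adjacent A~B (b∈pair x y)  (x∉pair (>⇒≢ᶠ x<y) y≢y')
                        (b∈pair x y') (x∉pair (>⇒≢ᶠ x'<y') (≢-sym y≢y')))
  ... | no x≢x' | yes refl | _ | _ = step-around x'<y' x<y
    (moved-adjacent A~B (b∈pair x y)  (x∉pair (>⇒≢ᶠ x'<y) (>⇒≢ᶠ x<y))
                        (a∈pair x' x) (x∉pair (≢-sym x≢x') (<⇒≢ᶠ x'<y)))
    where x'<y = <-trans x'<y' x<y
  ... | no x≢x' | no _ | yes refl | _ = DifferenceStep-sym (step-around x<y x'<y'
    (moved-adjacent (adjacent-sym A~B) (b∈pair y y') (x∉pair (>⇒≢ᶠ x<y') (>⇒≢ᶠ x'<y'))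
                                       (a∈pair x y)  (x∉pair x≢x' (<⇒≢ᶠ x<y'))))
    where x<y' = <-trans x<y x'<y'
  ... | no x≢x' | no _ | no _ | yes refl = step-shared-hi x<y x'<y'
    (moved-adjacent A~B (a∈pair x y)  (x∉pair x≢x' (<⇒≢ᶠ x<y))
                        (a∈pair x' y) (x∉pair (≢-sym x≢x') (<⇒≢ᶠ x'<y')))
  ... | no x≢x' | no x≢y' | no y≢x' | no y≢y' =
    ⊥-elim (adjacent-disjoint-impossible (<⇒≢ᶠ x<y) A~B x≢x' x≢y' y≢x' y≢y')

  -- Of the vertices at circular distance k only those with difference exactly p - k count:
  -- for odd p all of them together form an odd cycle of F₂(C_p).
  Good : ℕ → Set
  Good e = (Odd e × e < k) ⊎ (Odd (p ∸ e) × p ∸ e < k) ⊎ (p ∸ e ≡ k × Odd k)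

  odd-suc-odd : ∀ n → Odd n → ¬ Odd (suc n)
  odd-suc-odd n odd odd' = contradiction (trans (sym (cong not odd)) odd') λ ()

  ≤k+<k≢p : ∀ {a b} → a ≤ k → b < k → a + b ≢ p
  ≤k+<k≢p a≤k b<k a+b≡p = <-irrefl a+b≡p (<-≤-trans (+-mono-≤-< a≤k b<k) k+k≤p)

  good-consecutive : ∀ {e} → suc e < p → Good e → ¬ Good (suc e)
  good-consecutive {e} 1+e<p = go
    where
    p∸e≡1+p∸[1+e] : p ∸ e ≡ suc (p ∸ suc e)
    p∸e≡1+p∸[1+e] = ∸-suc (<-trans (n<1+n e) 1+e<p)
    [1+e]+p∸[1+e]≡p : suc e + (p ∸ suc e) ≡ p
    [1+e]+p∸[1+e]≡p = m+[n∸m]≡n (<⇒≤ 1+e<p)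
    e+p∸e≡p : e + (p ∸ e) ≡ p
    e+p∸e≡p = m+[n∸m]≡n (<⇒≤ (<-trans (n<1+n e) 1+e<p))
    1+e≡k : p ∸ suc e ≡ k → e < k → suc e ≡ k
    1+e≡k p∸[1+e]≡k e<k = ≤-antisym e<k (+-cancelʳ-≤ k k (suc e) (begin
      k + k            ≤⟨ k+k≤p ⟩
      p                ≡⟨ [1+e]+p∸[1+e]≡p ⟨
      suc e + (p ∸ suc e) ≡⟨ cong (suc e +_) p∸[1+e]≡k ⟩
      suc e + k        ∎))
      where open ≤-Reasoning
    go : Good e → ¬ Good (suc e)
    go (inj₁ (odd , _))   (inj₁ (odd' , _)) = odd-suc-odd e odd odd'
    go (inj₁ (_ , e<k))   (inj₂ (inj₁ (_ , <k))) = ≤k+<k≢p e<k <k [1+e]+p∸[1+e]≡p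
    go (inj₁ (odd , e<k)) (inj₂ (inj₂ (≡k , oddk))) =
      odd-suc-odd e odd (subst Odd (sym (1+e≡k ≡k e<k)) oddk)
    go (inj₂ (inj₁ (_ , <k))) (inj₁ (_ , 1+e<k)) = ≤k+<k≢p (<⇒≤ (<-trans (n<1+n e) 1+e<k)) <k e+p∸e≡p
    go (inj₂ (inj₁ (odd , _))) (inj₂ (inj₁ (odd' , _))) =
      odd-suc-odd (p ∸ suc e) odd' (subst Odd p∸e≡1+p∸[1+e] odd)
    go (inj₂ (inj₁ (odd , _))) (inj₂ (inj₂ (≡k , oddk))) =
      odd-suc-odd k oddk (subst Odd (trans p∸e≡1+p∸[1+e] (cong suc ≡k)) odd)
    go (inj₂ (inj₂ (≡k , _))) (inj₁ (_ , 1+e<k)) =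
      ≤k+<k≢p ≤-refl (<-trans (n<1+n e) 1+e<k) (trans (+-comm k e) (subst (λ n → e + n ≡ p) ≡k e+p∸e≡p))
    go (inj₂ (inj₂ (≡k , oddk))) (inj₂ (inj₁ (odd' , _))) =
      odd-suc-odd (p ∸ suc e) odd' (subst Odd (trans (sym ≡k) p∸e≡1+p∸[1+e]) oddk)
    go (inj₂ (inj₂ (≡k , _))) (inj₂ (inj₂ (≡k' , _))) =
      <-irrefl (trans (sym ≡k) (trans p∸e≡1+p∸[1+e] (cong suc ≡k'))) (n<1+n k)

  good-complementary : ∀ {e e'} → suc (e + e') ≡ p → Good e → ¬ Good e'
  good-complementary {e} {e'} 1+e+e'≡p = go
    where
    p∸e≡1+e' : p ∸ e ≡ suc e'
    p∸e≡1+e' = trans (cong (_∸ e) (sym (trans (+-suc e e') 1+e+e'≡p))) (m+n∸m≡n e (suc e'))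
    p∸e'≡1+e : p ∸ e' ≡ suc e
    p∸e'≡1+e = trans (cong (_∸ e') (sym (trans (+-suc e' e) (trans (cong suc (+-comm e' e)) 1+e+e'≡p))))
                     (m+n∸m≡n e' (suc e))
    sum≢p : suc e ≤ k → e' < k → ⊥
    sum≢p 1+e≤k e'<k = ≤k+<k≢p 1+e≤k e'<k 1+e+e'≡p
    1+e≤k : p ∸ e' < k ⊎ p ∸ e' ≡ k → suc e ≤ k
    1+e≤k (inj₁ <k) = <⇒≤ (subst (_< k) p∸e'≡1+e <k)
    1+e≤k (inj₂ ≡k) = ≤-reflexive (trans (sym p∸e'≡1+e) ≡k)
    e'<k : p ∸ e < k ⊎ p ∸ e ≡ k → e' < k
    e'<k (inj₁ <k) = <-trans (n<1+n e') (subst (_< k) p∸e≡1+e' <k)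
    e'<k (inj₂ ≡k) = ≤-reflexive (trans (sym p∸e≡1+e') ≡k)
    go : Good e → ¬ Good e'
    go (inj₁ (_ , e<k)) (inj₁ (_ , e'<k)) = sum≢p e<k e'<k
    go (inj₁ (odd , _)) (inj₂ (inj₁ (odd' , _))) = odd-suc-odd e odd (subst Odd p∸e'≡1+e odd')
    go (inj₁ (odd , _)) (inj₂ (inj₂ (≡k , oddk))) =
      odd-suc-odd e odd (subst Odd (trans (sym ≡k) p∸e'≡1+e) oddk)
    go (inj₂ (inj₁ (odd , _))) (inj₁ (odd' , _)) = odd-suc-odd e' odd' (subst Odd p∸e≡1+e' odd)
    go (inj₂ (inj₂ (≡k , oddk))) (inj₁ (odd' , _)) =
      odd-suc-odd e' odd' (subst Odd (trans (sym ≡k) p∸e≡1+e') oddk)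
    go (inj₂ (inj₁ (_ , <k))) (inj₂ (inj₁ (_ , <k'))) = sum≢p (1+e≤k (inj₁ <k')) (e'<k (inj₁ <k))
    go (inj₂ (inj₁ (_ , <k))) (inj₂ (inj₂ (≡k' , _))) = sum≢p (1+e≤k (inj₂ ≡k')) (e'<k (inj₁ <k))
    go (inj₂ (inj₂ (≡k , _))) (inj₂ (inj₁ (_ , <k'))) = sum≢p (1+e≤k (inj₁ <k')) (e'<k (inj₂ ≡k))
    go (inj₂ (inj₂ (≡k , _))) (inj₂ (inj₂ (≡k' , _))) = sum≢p (1+e≤k (inj₂ ≡k')) (e'<k (inj₂ ≡k))

  E<p : ∀ v → E v < p
  E<p v = ≤-<-trans (m∸n≤m (hi v) (lo v)) (hi<p v)

  good-nonadjacent : ∀ A B → Good (E A) → Good (E B) → ¬ TokenAdj (CycleAdj p) A B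
  good-nonadjacent A B good good' A~B with difference-step A B A~B
  ... | inj₁ EB≡1+EA        = good-consecutive (subst (_< p) EB≡1+EA (E<p B)) good (subst Good EB≡1+EA good')
  ... | inj₂ (inj₁ EA≡1+EB) = good-consecutive (subst (_< p) EA≡1+EB (E<p A)) good' (subst Good EA≡1+EB good)
  ... | inj₂ (inj₂ sum≡p)   = good-complementary sum≡p good good'

  -- The lower bound

  vertex : ∀ u w → toFin u ≢ toFin w → V
  vertex u w u≢w with <-cmp (toℕ (toFin u)) (toℕ (toFin w))
  ... | tri< u<w _ _ = (toFin u , toFin w) , u<w
  ... | tri≈ _ u≡w _ = ⊥-elim (u≢w (toℕ-injective u≡w))
  ... | tri> _ _ w<u = (toFin w , toFin u) , w<u

  vertex-< : ∀ {u w} (u≢w : toFin u ≢ toFin w) → toℕ (toFin u) < toℕ (toFin w) →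
             lo (vertex u w u≢w) ≡ toℕ (toFin u) × hi (vertex u w u≢w) ≡ toℕ (toFin w)
  vertex-< {u} {w} _ u<w with <-cmp (toℕ (toFin u)) (toℕ (toFin w))
  ... | tri< _ _ _  = refl , refl
  ... | tri≈ u≮w _ _ = contradiction u<w u≮w
  ... | tri> u≮w _ _ = contradiction u<w u≮w

  vertex-sorted : ∀ {u w} (u≢w : toFin u ≢ toFin w) → u < w → w < p →
                  lo (vertex u w u≢w) ≡ u × hi (vertex u w u≢w) ≡ w
  vertex-sorted u≢w u<w w<p =
    trans (proj₁ sorted) (toℕ-toFin-< u<p) , trans (proj₂ sorted) (toℕ-toFin-< w<p)
    where
    u<p = <-trans u<w w<p
    sorted = vertex-< u≢w (subst₂ _<_ (sym (toℕ-toFin-< u<p)) (sym (toℕ-toFin-< w<p)) u<w)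

  vertex-> : ∀ {u w} (u≢w : toFin u ≢ toFin w) → toℕ (toFin w) < toℕ (toFin u) →
             lo (vertex u w u≢w) ≡ toℕ (toFin w) × hi (vertex u w u≢w) ≡ toℕ (toFin u)
  vertex-> {u} {w} _ w<u with <-cmp (toℕ (toFin u)) (toℕ (toFin w))
  ... | tri< _ _ w≮u = contradiction w<u w≮u
  ... | tri≈ _ _ w≮u = contradiction w<u w≮u
  ... | tri> _ _ _   = refl , refl

  circular-short : ∀ {X Y} → Y ∸ X ≤ k → circular X Y ≡ (X , Y ∸ X)
  circular-short {X} {Y} Y∸X≤k with Y ∸ X ≤? k
  ... | yes _    = refl
  ... | no Y∸X≰k = contradiction Y∸X≤k Y∸X≰k

  circular-long : ∀ {X Y} → ¬ Y ∸ X ≤ k → circular X Y ≡ (Y , p ∸ (Y ∸ X))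
  circular-long {X} {Y} Y∸X≰k with Y ∸ X ≤? k
  ... | yes Y∸X≤k = contradiction Y∸X≤k Y∸X≰k
  ... | no _      = refl

  p∸[k+r]≡k : p ∸ (k + r) ≡ k
  p∸[k+r]≡k = trans (cong (_∸ (k + r)) (+-assoc k k r)) (m+n∸n≡m k (k + r))

  h s N : ℕ
  h = k / 2
  s = k % 2
  N = p * h + s * k

  k≡s+h*2 : k ≡ s + h * 2
  k≡s+h*2 = m≡m%n+[m/n]*n k 2

  1+j*2<k : ∀ {j} → j < h → suc (j * 2) < k
  1+j*2<k {j} j<h = ≤-trans (*-monoˡ-≤ 2 j<h) (≤-trans (m≤n+m (h * 2) s) (≤-reflexive (sym k≡s+h*2)))

  isEven-double : ∀ j → isEven (j * 2) ≡ true
  isEven-double zero    = refl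
  isEven-double (suc j) = cong (λ b → not (not b)) (isEven-double j)

  -- The chosen vertices are numbered: {a, a + 2j + 1} gets a + j p, and {b, b + p - k} gets p h + b.
  layerIndex : ℕ × ℕ → ℕ
  layerIndex (a , d) = a + ((d ∸ 1) / 2) * p

  index : ℕ → ℕ → ℕ
  index X Y with Y ∸ X ≟ k + r
  ... | yes _ = p * h + X
  ... | no _  = layerIndex (circular X Y)

  index-top : ∀ {X Y} → Y ∸ X ≡ k + r → index X Y ≡ p * h + X
  index-top {X} {Y} Y∸X≡k+r with Y ∸ X ≟ k + r
  ... | yes _       = refl
  ... | no Y∸X≢k+r = contradiction Y∸X≡k+r Y∸X≢k+r

  index-layer : ∀ {X Y} → Y ∸ X ≢ k + r → index X Y ≡ layerIndex (circular X Y)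
  index-layer {X} {Y} Y∸X≢k+r with Y ∸ X ≟ k + r
  ... | yes Y∸X≡k+r = contradiction Y∸X≡k+r Y∸X≢k+r
  ... | no _        = refl

  IndexedGood : ℕ → ℕ → ℕ → Set
  IndexedGood i X Y = index X Y ≡ i × Good (Y ∸ X)

  layer-unwrapped : ∀ {a j} → j < h → IndexedGood (a + j * p) a (a + suc (j * 2))
  layer-unwrapped {a} {j} j<h = (begin
    index a (a + d)                  ≡⟨ index-layer {a} {a + d} E≢k+r ⟩
    layerIndex (circular a (a + d))  ≡⟨ cong layerIndex (circular-short {a} {a + d} E≤k) ⟩
    layerIndex (a , a + d ∸ a)       ≡⟨ cong (λ e → layerIndex (a , e)) E≡d ⟩
    a + (j * 2 / 2) * p              ≡⟨ cong (λ n → a + n * p) (m*n/n≡m j 2) ⟩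
    a + j * p                        ∎)
    , subst Good (sym E≡d) (inj₁ (cong not (isEven-double j) , d<k))
    where
    open ≡-Reasoning
    d = suc (j * 2)
    d<k = 1+j*2<k j<h
    E≡d : a + d ∸ a ≡ d
    E≡d = m+n∸m≡n a d
    E≤k : a + d ∸ a ≤ k
    E≤k = ≤-trans (≤-reflexive E≡d) (<⇒≤ d<k)
    E≢k+r : a + d ∸ a ≢ k + r
    E≢k+r eq = <-irrefl (trans (sym E≡d) eq) (<-≤-trans d<k (m≤m+n k r))

  p∸k≡k+r : p ∸ k ≡ k + r
  p∸k≡k+r = trans (cong (_∸ k) (+-assoc k k r)) (m+n∸m≡n k (k + r))

  k<p∸d : ∀ {d} → d < k → k < p ∸ d
  k<p∸d {d} d<k = m+n≤o⇒m≤o∸n (suc k) (begin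
    suc k + d  ≡⟨ +-comm (suc k) d ⟩
    d + suc k  ≡⟨ +-suc d k ⟩
    suc d + k  ≤⟨ +-monoˡ-≤ k d<k ⟩
    k + k      ≤⟨ k+k≤p ⟩
    p          ∎)
    where open ≤-Reasoning

  layer-wrapped : ∀ {a j} → j < h → p ≤ a + suc (j * 2) →
                  IndexedGood (a + j * p) (a + suc (j * 2) ∸ p) a
  layer-wrapped {a} {j} j<h p≤a+d = (begin
    index c a                        ≡⟨ index-layer {c} {a} (λ eq → <-irrefl (d≡k eq) d<k) ⟩
    layerIndex (circular c a)        ≡⟨ cong layerIndex (circular-long {c} {a} (<⇒≱ k<a∸c)) ⟩
    layerIndex (a , p ∸ (a ∸ c))     ≡⟨ cong (λ e → layerIndex (a , e)) p∸[a∸c]≡d ⟩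
    a + (j * 2 / 2) * p              ≡⟨ cong (λ n → a + n * p) (m*n/n≡m j 2) ⟩
    a + j * p                        ∎)
    , inj₂ (inj₁ (subst Odd (sym p∸[a∸c]≡d) (cong not (isEven-double j)) , subst (_< k) (sym p∸[a∸c]≡d) d<k))
    where
    open ≡-Reasoning
    d = suc (j * 2)
    d<k = 1+j*2<k j<h
    d≤p : d ≤ p
    d≤p = <⇒≤ (<-trans d<k k<p)
    c = a + d ∸ p
    c+[p∸d]≡a : c + (p ∸ d) ≡ a
    c+[p∸d]≡a = +-cancelʳ-≡ d (c + (p ∸ d)) a (begin
      c + (p ∸ d) + d    ≡⟨ +-assoc c (p ∸ d) d ⟩
      c + (p ∸ d + d)    ≡⟨ cong (c +_) (m∸n+n≡m d≤p) ⟩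
      c + p              ≡⟨ m∸n+n≡m p≤a+d ⟩
      a + d              ∎)
    a∸c≡p∸d : a ∸ c ≡ p ∸ d
    a∸c≡p∸d = trans (cong (_∸ c) (sym c+[p∸d]≡a)) (m+n∸m≡n c (p ∸ d))
    p∸[a∸c]≡d : p ∸ (a ∸ c) ≡ d
    p∸[a∸c]≡d = trans (cong (p ∸_) a∸c≡p∸d) (m∸[m∸n]≡n d≤p)
    d≡k : a ∸ c ≡ k + r → d ≡ k
    d≡k eq = ∸-cancelˡ-≡ d≤p (<⇒≤ k<p) (trans (sym a∸c≡p∸d) (trans eq (sym p∸k≡k+r)))
    k<a∸c : k < a ∸ c
    k<a∸c = subst (k <_) (sym a∸c≡p∸d) (k<p∸d d<k)

  top-vertex : ∀ {b} → s ≡ 1 → IndexedGood (p * h + b) b (b + (k + r))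
  top-vertex {b} s≡1 = index-top {b} {b + (k + r)} (m+n∸m≡n b (k + r))
    , inj₂ (inj₂ (trans (cong (p ∸_) (m+n∸m≡n b (k + r))) p∸[k+r]≡k , odd-k))
    where
    odd-k : Odd k
    odd-k = trans (cong isEven (trans k≡s+h*2 (cong (_+ h * 2) s≡1))) (cong not (isEven-double h))

  layer-vertex : ∀ {a j i} (a≢a+d : toFin a ≢ toFin (a + suc (j * 2))) → a < p → j < h → a + j * p ≡ i →
                 let v = vertex a (a + suc (j * 2)) a≢a+d in IndexedGood i (lo v) (hi v)
  layer-vertex {a} {j} {i} a≢a+d a<p j<h a+jp≡i with a + suc (j * 2) <? p
  ... | yes a+d<p = subst₂ (IndexedGood i) (sym (proj₁ sorted)) (sym (proj₂ sorted))
                      (subst (λ n → IndexedGood n a (a + suc (j * 2))) a+jp≡i (layer-unwrapped j<h))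
    where sorted = vertex-sorted a≢a+d (m<m+n a (s≤s z≤n)) a+d<p
  ... | no a+d≮p = subst₂ (IndexedGood i) (sym (trans lo≡ c≡)) (sym (trans hi≡ (toℕ-toFin-< a<p)))
                      (subst (λ n → IndexedGood n (a + suc (j * 2) ∸ p) a) a+jp≡i (layer-wrapped j<h p≤a+d))
    where
    d<p = <-trans (1+j*2<k j<h) k<p
    p≤a+d = ≮⇒≥ a+d≮p
    c≡ : toℕ (toFin (a + suc (j * 2))) ≡ a + suc (j * 2) ∸ p
    c≡ = toℕ-toFin-≥ p≤a+d (+-mono-< a<p d<p)
    c<a : a + suc (j * 2) ∸ p < a
    c<a = +-cancelʳ-< p _ a (subst (_< a + p) (sym (m∸n+n≡m p≤a+d)) (+-monoʳ-< a d<p))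
    sorted = vertex-> a≢a+d (subst₂ _<_ (sym c≡) (sym (toℕ-toFin-< a<p)) c<a)
    lo≡ = proj₁ sorted
    hi≡ = proj₂ sorted

  0<k+r : 0 < k + r
  0<k+r = <-≤-trans 1≤k (m≤m+n k r)

  k+r<p : k + r < p
  k+r<p = subst (k + r <_) (sym (+-assoc k k r)) (m<n+m (k + r) 1≤k)

  top<p : ∀ {b} → b < k → b + (k + r) < p
  top<p {b} b<k = subst (b + (k + r) <_) (sym (+-assoc k k r)) (+-monoˡ-< (k + r) b<k)

  i/p<h : ∀ {i} → i < p * h → i / p < h
  i/p<h {i} i<ph = m<n*o⇒m/o<n (subst (i <_) (*-comm p h) i<ph)

  chosen : ℕ → V
  chosen i with i <? p * h
  ... | yes i<ph = vertex (i % p) (i % p + suc ((i / p) * 2))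
                     (toFin-+-≢ (i % p) (s≤s z≤n) (<-trans (1+j*2<k (i/p<h i<ph)) k<p))
  ... | no _     = vertex (i ∸ p * h) (i ∸ p * h + (k + r)) (toFin-+-≢ (i ∸ p * h) 0<k+r k+r<p)

  s≡0⊎s≡1 : s ≡ 0 ⊎ s ≡ 1
  s≡0⊎s≡1 = go (m%n<n k 2)
    where
    go : ∀ {s} → s < 2 → s ≡ 0 ⊎ s ≡ 1
    go (s≤s z≤n)       = inj₁ refl
    go (s≤s (s≤s z≤n)) = inj₂ refl

  chosen-indexed : ∀ {i} → i < N → IndexedGood i (lo (chosen i)) (hi (chosen i))
  chosen-indexed {i} i<N with i <? p * h
  ... | yes i<ph = layer-vertex _ (m%n<n i p) (i/p<h i<ph) (sym (m≡m%n+[m/n]*n i p))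
  ... | no i≮ph with s≡0⊎s≡1
  ...   | inj₁ s≡0 = contradiction (subst (i <_) N≡ph i<N) i≮ph
    where
    N≡ph : N ≡ p * h
    N≡ph = trans (cong (λ t → p * h + t * k) s≡0) (+-identityʳ (p * h))
  ...   | inj₂ s≡1 = subst₂ (IndexedGood i) (sym (proj₁ sorted)) (sym (proj₂ sorted))
                       (subst (λ n → IndexedGood n b (b + (k + r))) ph+b≡i (top-vertex s≡1))
    where
    b = i ∸ p * h
    ph+b≡i : p * h + b ≡ i
    ph+b≡i = m+[n∸m]≡n (≮⇒≥ i≮ph)
    N≡ph+k : N ≡ p * h + k
    N≡ph+k = trans (cong (λ t → p * h + t * k) s≡1) (cong (p * h +_) (*-identityˡ k))
    b<k : b < k
    b<k = +-cancelˡ-< (p * h) b k (subst₂ _<_ (sym ph+b≡i) N≡ph+k i<N)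
    sorted = vertex-sorted (toFin-+-≢ b 0<k+r k+r<p) (m<m+n b 0<k+r) (top<p b<k)

  lo-hi-injective : ∀ A B → toSubset A ≡ toSubset B → lo A ≡ lo B × hi A ≡ hi B
  lo-hi-injective ((x , y) , x<y) ((x' , y') , x'<y') eq with pair-injective x<y x'<y' eq
  ... | refl , refl = refl , refl

  chosen-independent : IsIndependent (CycleAdj p) (applyUpTo chosen N)
  chosen-independent = applyUpTo⁺₁ chosen N independent
    where
    independent : ∀ {i j} → i < j → j < N → Independent (chosen i) (chosen j)
    independent {i} {j} i<j j<N =
      distinct , good-nonadjacent (chosen i) (chosen j) good-i good-j , good-nonadjacent (chosen j) (chosen i) good-j good-i
      where
      indexed-i = chosen-indexed (<-trans i<j j<N)
      indexed-j = chosen-indexed j<N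
      good-i = proj₂ indexed-i
      good-j = proj₂ indexed-j
      distinct : toSubset (chosen i) ≢ toSubset (chosen j)
      distinct eq with lo-hi-injective (chosen i) (chosen j) eq
      ... | lo≡ , hi≡ =
        <-irrefl (trans (sym (proj₁ indexed-i)) (trans (cong₂ index lo≡ hi≡) (proj₁ indexed-j))) i<j

  p/2≡k : p / 2 ≡ k
  p/2≡k = begin
    (k + k + r) / 2  ≡⟨ cong (_/ 2) (k+k+r≡r+k*2 k r) ⟩
    (r + k * 2) / 2  ≡⟨ [m+n*2]/2≡m/2+n r k ⟩
    r / 2 + k        ≡⟨ cong (_+ k) (m<n⇒m/n≡0 (s≤s r≤1)) ⟩
    k                ∎
    where open ≡-Reasoning

  ps/2≡s*k : (p * s) / 2 ≡ s * k
  ps/2≡s*k with s≡0⊎s≡1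
  ... | inj₁ s≡0 = trans (cong (λ t → (p * t) / 2) s≡0) (trans (cong (_/ 2) (*-zeroʳ p)) (sym (cong (_* k) s≡0)))
  ... | inj₂ s≡1 = trans (cong (λ t → (p * t) / 2) s≡1) (trans (cong (_/ 2) (*-identityʳ p))
                     (trans p/2≡k (trans (sym (+-identityʳ k)) (sym (cong (_* k) s≡1)))))

  pk/2≡N : (p * k) / 2 ≡ N
  pk/2≡N = begin
    (p * k) / 2                ≡⟨ cong (λ t → (p * t) / 2) k≡s+h*2 ⟩
    (p * (s + h * 2)) / 2      ≡⟨ cong (_/ 2) (distrib p s h) ⟩
    (p * s + (p * h) * 2) / 2  ≡⟨ [m+n*2]/2≡m/2+n (p * s) (p * h) ⟩
    (p * s) / 2 + p * h        ≡⟨ cong (_+ p * h) ps/2≡s*k ⟩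
    s * k + p * h              ≡⟨ +-comm (s * k) (p * h) ⟩
    N                          ∎
    where
    open ≡-Reasoning
    distrib : ∀ p s h → p * (s + h * 2) ≡ p * s + (p * h) * 2
    distrib = solve-∀

  independence-number : IndependenceNumber (CycleAdj p) ((p * (p / 2)) / 2)
  independence-number rewrite p/2≡k =
    (applyUpTo chosen N , chosen-independent , trans (length-applyUpTo chosen N) (sym pk/2≡N)) ,
    λ S independent → n+n≤m⇒n≤m/2 (twice-length≤ S independent)


theorem1p3 : (p : ℕ) → p ≥ 3 →
    IndependenceNumber (CycleAdj p) ((p * (p / 2)) / 2)
theorem1p3 p 3≤p = subst (λ q → IndependenceNumber (CycleAdj q) ((q * (q / 2)) / 2)) k+k+r≡p
  (CycleGraph.independence-number (p / 2) (p % 2) (≤-pred (m%n<n p 2)) (subst (3 ≤_) (sym k+k+r≡p) 3≤p))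
  where
  k+k+r≡p : p / 2 + p / 2 + p % 2 ≡ p
  k+k+r≡p = trans (k+k+r≡r+k*2 (p / 2) (p % 2)) (sym (m≡m%n+[m/n]*n p 2))
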